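{- Let $T$ be a tree with $n$ vertices and let $k\ge 3$ be an integer. If $\mathrm{OPT}$ denotes the size of an optimal (minimum-size) $(3,k-2)$-completion set of $T$, then $(n-1)\cdot\frac{k-2}{2}\le \mathrm{OPT}$.
   Context: A connected graph has a $(3,\ell)$-cover if each of its edges lies in at least $\ell$ triangles. For a graph $G=(V,E)$, a set $E'$ of non-edges of $G$ is a $(3,\ell)$-completion set of $G$ if $(V,E\cup E')$ has a $(3,\ell)$-cover. -}

module Defs where

open import Data.Nat using (ℕ; zero; suc; _+_; _<_)
open import Data.Bool using (Bool; true; false; if_then_else_; _∨_)
open import Data.Fin using (Fin; zero; suc; inject₁; fromℕ; toℕ)
open import Data.List using (List; allFin; map)
open import Data.Nat.ListAction using (sum)
open import Data.Product using (Σ; _×_)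
open import Relation.Binary.PropositionalEquality using (_≡_)
open import Function.Definitions using (Injective)
open import Relation.Nullary using (¬_)

record Graph (n : ℕ) : Set where
  field
    adj    : Fin n → Fin n → Bool
    sym    : ∀ u v → adj u v ≡ adj v u
    irrefl : ∀ u → adj u u ≡ false
open Graph public

count : (n : ℕ) → (Fin n → Bool) → ℕ
count n p = sum (map (λ i → if p i then 1 else 0) (allFin n))

numEdges : {n : ℕ} → Graph n → ℕ
numEdges {n} G = sum (map (λ u → count n (λ v → lt u v)) (allFin n))
  where
  ltℕ : ℕ → ℕ → Bool
  ltℕ zero    (suc _) = true
  ltℕ _       zero    = false
  ltℕ (suc a) (suc b) = ltℕ a b
  lt : Fin n → Fin n → Bool
  lt u v = if ltℕ (toℕ u) (toℕ v) then adj G u v else false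

data Reachable {n : ℕ} (G : Graph n) : Fin n → Fin n → Set where
  here : ∀ {u} → Reachable G u u
  step : ∀ {u w v} → adj G u w ≡ true → Reachable G w v → Reachable G u v

Connected : {n : ℕ} → Graph n → Set
Connected G = ∀ u v → Reachable G u v

-- a cycle of length m + 3: distinct vertices c 0, ..., c (m+2) with
-- consecutive ones adjacent and the last adjacent to the first
record Cycle {n : ℕ} (G : Graph n) : Set where
  field
    m     : ℕ
    c     : Fin (suc (suc (suc m))) → Fin n
    inj   : Injective _≡_ _≡_ c
    path  : ∀ (i : Fin (suc (suc m))) → adj G (c (inject₁ i)) (c (suc i)) ≡ true
    close : adj G (c (fromℕ (suc (suc m)))) (c zero) ≡ true

Acyclic : {n : ℕ} → Graph n → Set
Acyclic G = ¬ Cycle G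

IsTree : {n : ℕ} → Graph n → Set
IsTree G = Connected G × Acyclic G

triangles : {n : ℕ} → Graph n → Fin n → Fin n → ℕ
triangles {n} G u v = count n (λ w → if adj G u w then adj G v w else false)

Has3Cover : {n : ℕ} → ℕ → Graph n → Set
Has3Cover ℓ G = Connected G × (∀ u v → adj G u v ≡ true → ℓ Data.Nat.≤ triangles G u v)

union : {n : ℕ} → Graph n → Graph n → Graph n
union G H = record
  { adj    = λ u v → adj G u v ∨ adj H u v
  ; sym    = λ u v → cong₂ _∨_ (Graph.sym G u v) (Graph.sym H u v)
  ; irrefl = λ u → cong₂ _∨_ (Graph.irrefl G u) (Graph.irrefl H u)
  }
  where open import Relation.Binary.PropositionalEquality using (cong₂)

-- E' (given as a graph H on the same vertices) is a (3,ℓ)-completion set of G: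
-- all its edges are non-edges of G, and G ∪ E' has a (3,ℓ)-cover
IsCompletionSet : {n : ℕ} → ℕ → Graph n → Graph n → Set
IsCompletionSet ℓ G H =
  (∀ u v → adj H u v ≡ true → adj G u v ≡ false) × Has3Cover ℓ (union G H)

{-# OPTIONS --safe #-}

-- Root T at vertex 0: its edges are {v, parent v} for the n − 1 vertices v ≠ 0, and each of
-- them lies in at least k − 2 triangles of U = T ∪ E'. Fix the apex y of such a triangle and
-- orient the tree edge away from y. Its far endpoint x is not a T-neighbour of y (the near
-- endpoint would then be y itself), so xy ∈ E'; and x determines the tree edge, since in a
-- tree a vertex has only one neighbour closer to y. So at most deg_E' y tree edges have
-- apex y, and summing over y gives (n − 1)(k − 2) ≤ Σ_y deg_E' y = 2|E'|.

module Submission where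

open import Defs
open import Data.Nat using (ℕ; zero; suc; _+_; _*_; _∸_; _≤_; _<_; z≤n; s≤s; s≤s⁻¹)
open import Data.Nat.Properties
  using (+-0-commutativeMonoid; +-mono-≤; +-identityʳ; m≤n+m; ≤-refl; ≤-reflexive; ≤-trans; ≤-antisym;
         <⇒≤; <⇒≱; <-asym; <-cmp; n≮n; n≤0⇒n≡0; n≤1+n; suc-injective)
open import Algebra.Properties.CommutativeMonoid.Sum +-0-commutativeMonoid
  using (sum-syntax; sum-cong-≗; ∑-distrib-+; ∑-comm)
open import Data.Bool using (Bool; true; false; if_then_else_; _∨_; _∧_)
open import Data.Bool.Properties using (¬-not) renaming (_≟_ to _≟ᵇ_)
open import Data.Fin using (Fin; zero; suc; toℕ; inject₁; fromℕ; opposite)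
open import Data.Fin.Properties using (0≢1+n; opposite-involutive; toℕ-injective; any?)
  renaming (_≟_ to _≟ᶠ_; suc-injective to Fin-suc-injective)
open import Data.List using (allFin; map; tabulate)
open import Data.List.Properties using (map-tabulate)
open import Data.Nat.ListAction using () renaming (sum to sumˡ)
open import Data.Vec.Functional using (_∷_)
open import Data.Product using (∃-syntax; _×_; _,_; proj₁; proj₂)
open import Data.Sum using (_⊎_; inj₁; inj₂)
open import Data.Empty using (⊥; ⊥-elim)
open import Function using (_∘_; id)
open import Function.Definitions using (Injective)
open import Relation.Binary.Definitions using (tri<; tri≈; tri>)
open import Relation.Binary.PropositionalEquality as ≡
  using (_≡_; _≢_; refl; trans; cong; subst; subst₂)
open import Relation.Nullary using (¬_; yes; no; does; contradiction)
open import Relation.Nullary.Decidable using (_⊎-dec_; _×-dec_)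
open import Relation.Unary using (Decidable)

[_] : Bool → ℕ
[ b ] = if b then 1 else 0

sumˡ-tabulate : ∀ {n} (f : Fin n → ℕ) → sumˡ (tabulate f) ≡ ∑[ i < n ] f i
sumˡ-tabulate {zero}  f = refl
sumˡ-tabulate {suc n} f = cong (f zero +_) (sumˡ-tabulate (f ∘ suc))

sumˡ-map-allFin : ∀ {n} (f : Fin n → ℕ) → sumˡ (map f (allFin n)) ≡ ∑[ i < n ] f i
sumˡ-map-allFin f = trans (cong sumˡ (map-tabulate id f)) (sumˡ-tabulate f)

count≡∑ : ∀ n (p : Fin n → Bool) → count n p ≡ ∑[ i < n ] [ p i ]
count≡∑ n p = sumˡ-map-allFin (λ i → [ p i ])

∑-mono-≤ : ∀ {n} {f g : Fin n → ℕ} → (∀ i → f i ≤ g i) → ∑[ i < n ] f i ≤ ∑[ i < n ] g i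
∑-mono-≤ {zero}  _   = z≤n
∑-mono-≤ {suc n} f≤g = +-mono-≤ (f≤g zero) (∑-mono-≤ (f≤g ∘ suc))

n*c≤∑ : ∀ {n} c {f : Fin n → ℕ} → (∀ i → c ≤ f i) → n * c ≤ ∑[ i < n ] f i
n*c≤∑ {zero}  c _   = z≤n
n*c≤∑ {suc n} c c≤f = +-mono-≤ (c≤f zero) (n*c≤∑ c (c≤f ∘ suc))

∑[false]≡0 : ∀ {n} (p : Fin n → Bool) → (∀ i → p i ≡ false) → ∑[ i < n ] [ p i ] ≡ 0
∑[false]≡0 {zero}  p _    = refl
∑[false]≡0 {suc n} p none rewrite none zero = ∑[false]≡0 (p ∘ suc) (none ∘ suc)

∑[unique]≤1 : ∀ {n} {p : Fin n → Bool} → (∀ i j → p i ≡ true → p j ≡ true → i ≡ j) →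
              ∑[ i < n ] [ p i ] ≤ 1
∑[unique]≤1 {zero}          _      = z≤n
∑[unique]≤1 {suc n} {p} unique with p zero in p₀
... | true  = ≤-reflexive (cong suc (∑[false]≡0 (p ∘ suc) rest-false))
  where
  rest-false : ∀ i → p (suc i) ≡ false
  rest-false i = ¬-not (0≢1+n ∘ unique zero (suc i) p₀)
... | false = ∑[unique]≤1 (λ i j pᵢ pⱼ → Fin-suc-injective (unique (suc i) (suc j) pᵢ pⱼ))

∑[b∧j≟x]≡[b] : ∀ {n} b (j : Fin n) → ∑[ x < n ] [ b ∧ does (j ≟ᶠ x) ] ≡ [ b ]
∑[b∧j≟x]≡[b] {n}     false j       = ∑[false]≡0 {n} _ (λ _ → refl)
∑[b∧j≟x]≡[b] {suc n} true  zero    = cong suc (∑[false]≡0 {n} _ (λ _ → refl))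
∑[b∧j≟x]≡[b] {suc n} true  (suc j) = ∑[b∧j≟x]≡[b] true j

∑-≤-injection : ∀ {m n} {p : Fin m → Bool} {q : Fin n → Bool} (f : Fin m → Fin n) →
                Injective _≡_ _≡_ f → (∀ i → p i ≡ true → q (f i) ≡ true) →
                ∑[ i < m ] [ p i ] ≤ ∑[ x < n ] [ q x ]
∑-≤-injection {m} {n} {p} {q} f f-inj p⇒q = begin
  ∑[ i < m ] [ p i ]
    ≡⟨ sum-cong-≗ (λ i → ≡.sym (∑[b∧j≟x]≡[b] (p i) (f i))) ⟩
  ∑[ i < m ] ∑[ x < n ] [ p i ∧ does (f i ≟ᶠ x) ]
    ≡⟨ ∑-comm {m} {n} _ ⟩
  ∑[ x < n ] ∑[ i < m ] [ p i ∧ does (f i ≟ᶠ x) ]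
    ≤⟨ ∑-mono-≤ fibre ⟩
  ∑[ x < n ] [ q x ]
    ∎
  where
  open Data.Nat.Properties.≤-Reasoning
  hit : ∀ {x} i → (p i ∧ does (f i ≟ᶠ x)) ≡ true → q x ≡ true × f i ≡ x
  hit {x} i h with p i in pᵢ | f i ≟ᶠ x
  ... | true | yes refl = p⇒q i pᵢ , refl
  fibre : ∀ x → ∑[ i < m ] [ p i ∧ does (f i ≟ᶠ x) ] ≤ [ q x ]
  fibre x with q x in qx
  ... | true  = ∑[unique]≤1 λ i j hᵢ hⱼ → f-inj (trans (proj₂ (hit i hᵢ)) (≡.sym (proj₂ (hit j hⱼ))))
  ... | false = ≤-reflexive (∑[false]≡0 _ λ i → ¬-not λ h →
                  contradiction (trans (≡.sym (proj₁ (hit i h))) qx) λ ())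

Edge : ∀ {n} → Graph n → Fin n → Fin n → Set
Edge G u v = adj G u v ≡ true

edge-sym : ∀ {n} (G : Graph n) {u v} → Edge G u v → Edge G v u
edge-sym G {u} {v} e = trans (Graph.sym G v u) e

edge-irrefl : ∀ {n} (G : Graph n) {u v} → Edge G u v → u ≢ v
edge-irrefl G {u} e refl with trans (≡.sym e) (irrefl G u)
... | ()

union-introˡ : ∀ {n} (G H : Graph n) {u v} → Edge G u v → Edge (union G H) u v
union-introˡ G H e = cong (_∨ _) e

union-elimʳ : ∀ {n} (G H : Graph n) {u v} → Edge (union G H) u v → adj G u v ≡ false → Edge H u v
union-elimʳ G H {u} {v} e ¬e = subst (λ b → (b ∨ adj H u v) ≡ true) ¬e e

[a]≤[b]+[c] : ∀ {a b c} → (a ≡ true → b ≡ true ⊎ c ≡ true) → [ a ] ≤ [ b ] + [ c ]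
[a]≤[b]+[c] {false} _ = z≤n
[a]≤[b]+[c] {true}  a⇒b∨c with a⇒b∨c refl
... | inj₁ refl = s≤s z≤n
... | inj₂ refl = m≤n+m 1 _

if-true⁺ : ∀ {a b} → a ≡ true → b ≡ true → (if a then b else false) ≡ true
if-true⁺ refl b≡true = b≡true

if-true⁻ : ∀ {a b} → (if a then b else false) ≡ true → a ≡ true × b ≡ true
if-true⁻ {true} b≡true = refl , b≡true

degree : ∀ {n} → Graph n → Fin n → ℕ
degree {n} G x = ∑[ y < n ] [ adj G x y ]

-- numEdges tests pairs with functions local to its where-block, which cannot be named here;
-- each `_` below is solved by unification against the `refl` after it, and so is
-- definitionally that local test (resp. the order on indices inside it).
mutual
  edgeTest : ∀ {n} → Graph n → Fin n → Fin n → Bool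
  edgeTest = _

  numEdges-unfold : ∀ {n} (G : Graph n) →
                    numEdges G ≡ sumˡ (map (λ u → count n (edgeTest G u)) (allFin n))
  numEdges-unfold G = refl

mutual
  indexLess : ∀ {n} → Graph n → ℕ → ℕ → Bool
  indexLess = _

  edgeTest-unfold : ∀ {n} (G : Graph n) u v →
                    edgeTest G u v ≡ (if indexLess G (toℕ u) (toℕ v) then adj G u v else false)
  edgeTest-unfold G u v with toℕ u | toℕ v
  ... | a | b = refl

indexLess-total : ∀ {n} (G : Graph n) {a b} → a ≢ b → indexLess G a b ≡ true ⊎ indexLess G b a ≡ true
indexLess-total G {zero}  {zero}  a≢b = ⊥-elim (a≢b refl)
indexLess-total G {zero}  {suc b} _   = inj₁ refl
indexLess-total G {suc a} {zero}  _   = inj₂ refl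
indexLess-total G {suc a} {suc b} a≢b = indexLess-total G (a≢b ∘ cong suc)

edgeTest-total : ∀ {n} (G : Graph n) {u v} → Edge G u v → edgeTest G u v ≡ true ⊎ edgeTest G v u ≡ true
edgeTest-total G {u} {v} e with indexLess-total G {toℕ u} {toℕ v} (edge-irrefl G e ∘ toℕ-injective)
... | inj₁ u<v = inj₁ (trans (edgeTest-unfold G u v) (if-true⁺ u<v e))
... | inj₂ v<u = inj₂ (trans (edgeTest-unfold G v u) (if-true⁺ v<u (edge-sym G e)))

numEdges≡∑ : ∀ {n} (G : Graph n) → numEdges G ≡ ∑[ u < n ] ∑[ v < n ] [ edgeTest G u v ]
numEdges≡∑ {n} G = trans (numEdges-unfold G)
  (trans (sumˡ-map-allFin {n} _) (sum-cong-≗ (λ u → count≡∑ n (edgeTest G u))))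

handshake : ∀ {n} (G : Graph n) → ∑[ x < n ] degree G x ≤ 2 * numEdges G
handshake {n} G = begin
  ∑[ x < n ] ∑[ y < n ] [ adj G x y ]
    ≤⟨ ∑-mono-≤ {n} (λ x → ∑-mono-≤ (adj≤tests x)) ⟩
  ∑[ x < n ] ∑[ y < n ] ([ edgeTest G x y ] + [ edgeTest G y x ])
    ≡⟨ sum-cong-≗ {n} (λ x → ∑-distrib-+ {n} _ _) ⟩
  ∑[ x < n ] (∑[ y < n ] [ edgeTest G x y ] + ∑[ y < n ] [ edgeTest G y x ])
    ≡⟨ ∑-distrib-+ {n} _ _ ⟩
  N + ∑[ x < n ] ∑[ y < n ] [ edgeTest G y x ]
    ≡⟨ cong (N +_) (∑-comm {n} {n} (λ x y → [ edgeTest G y x ])) ⟩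
  N + N
    ≡⟨ cong (N +_) (≡.sym (+-identityʳ N)) ⟩
  2 * N
    ≡⟨ cong (2 *_) (≡.sym (numEdges≡∑ G)) ⟩
  2 * numEdges G
    ∎
  where
  open Data.Nat.Properties.≤-Reasoning
  N = ∑[ x < n ] ∑[ y < n ] [ edgeTest G x y ]
  adj≤tests : ∀ x y → [ adj G x y ] ≤ [ edgeTest G x y ] + [ edgeTest G y x ]
  adj≤tests x y = [a]≤[b]+[c] (edgeTest-total G)

opposite-inject₁ : ∀ {k} (i : Fin k) → opposite (inject₁ i) ≡ suc (opposite i)
opposite-inject₁ zero    = refl
opposite-inject₁ (suc i) = cong inject₁ (opposite-inject₁ i)

opposite-fromℕ : ∀ k → opposite (fromℕ k) ≡ zero
opposite-fromℕ zero    = refl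
opposite-fromℕ (suc k) = cong inject₁ (opposite-fromℕ k)

opposite-injective : ∀ {k} → Injective _≡_ _≡_ (opposite {k})
opposite-injective {k} {i} {j} e =
  trans (≡.sym (opposite-involutive i)) (trans (cong opposite e) (opposite-involutive j))

record Path {n} (G : Graph n) (k : ℕ) : Set where
  field
    vertex   : Fin (suc k) → Fin n
    distinct : Injective _≡_ _≡_ vertex
    linked   : ∀ i → Edge G (vertex (inject₁ i)) (vertex (suc i))

  first last : Fin n
  first = vertex zero
  last  = vertex (fromℕ k)

open Path

module _ {n} {G : Graph n} where

  record All (P : Fin n → Set) {k} (p : Path G k) : Set where
    constructor all
    field holds : ∀ i → P (vertex p i)

  open All public

  singleton : Fin n → Path G 0
  singleton x = record { vertex = λ _ → x ; distinct = λ { {zero} {zero} _ → refl } ; linked = λ () }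

  prepend : ∀ {k} x (p : Path G k) → Edge G x (first p) → All (_≢ x) p → Path G (suc k)
  prepend x p x—p fresh = record { vertex = x ∷ vertex p ; distinct = distinct' ; linked = linked' }
    where
    distinct' : Injective _≡_ _≡_ (x ∷ vertex p)
    distinct' {zero}  {zero}  _ = refl
    distinct' {zero}  {suc j} e = ⊥-elim (holds fresh j (≡.sym e))
    distinct' {suc i} {zero}  e = ⊥-elim (holds fresh i e)
    distinct' {suc i} {suc j} e = cong suc (distinct p e)
    linked' : ∀ i → Edge G ((x ∷ vertex p) (inject₁ i)) ((x ∷ vertex p) (suc i))
    linked' zero    = x—p
    linked' (suc i) = linked p i

  reverse : ∀ {k} → Path G k → Path G k
  reverse p = record
    { vertex = vertex p ∘ opposite ; distinct = opposite-injective ∘ distinct p ; linked = linked' }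
    where
    linked' : ∀ i → Edge G (vertex p (opposite (inject₁ i))) (vertex p (opposite (suc i)))
    linked' i rewrite opposite-inject₁ i = edge-sym G (linked p (opposite i))

  last-reverse : ∀ {k} (p : Path G k) → last (reverse p) ≡ first p
  last-reverse {k} p = cong (vertex p) (opposite-fromℕ k)

  All-prepend : ∀ {P k x} {p : Path G k} {x—p fresh} → P x → All P p → All P (prepend x p x—p fresh)
  All-prepend Px Pp = all λ { zero → Px ; (suc i) → holds Pp i }

  All-reverse : ∀ {P k} {p : Path G k} → All P p → All P (reverse p)
  All-reverse Pp = all (holds Pp ∘ opposite)

  close : ∀ {m} (p : Path G (suc (suc m))) → Edge G (last p) (first p) → Cycle G
  close {m} p last—first =
    record { m = m ; c = vertex p ; inj = distinct p ; path = linked p ; close = last—first }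

least : ∀ {P : ℕ → Set} → Decidable P → ∀ {n} → P n → ∃[ m ] (P m × (∀ {k} → P k → m ≤ k))
least {P} P? {zero}  P0 = 0 , P0 , λ _ → z≤n
least {P} P? {suc n} Pn with P? 0
... | yes P0 = 0 , P0 , λ _ → z≤n
... | no ¬P0 with least (P? ∘ suc) Pn
...   | m , Pm , min = suc m , Pm , minimal
  where
  minimal : ∀ {k} → P k → suc m ≤ k
  minimal {zero}  P0 = contradiction P0 ¬P0
  minimal {suc k} Pk = s≤s (min Pk)

module Distance {n} (G : Graph n) (connected : Connected G) (root : Fin n) where

  Near : ℕ → Fin n → Set
  Near zero    x = x ≡ root
  Near (suc i) x = Near i x ⊎ ∃[ y ] (Edge G x y × Near i y)

  near? : ∀ i → Decidable (Near i)
  near? zero    x = x ≟ᶠ root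
  near? (suc i) x = near? i x ⊎-dec any? (λ y → (adj G x y ≟ᵇ true) ×-dec near? i y)

  reachable⇒near : ∀ {x} → Reachable G x root → ∃[ i ] Near i x
  reachable⇒near here           = 0 , refl
  reachable⇒near (step x—y y⇝r) =
    let (i , near) = reachable⇒near y⇝r in suc i , inj₂ (_ , x—y , near)

  private
    nearest : ∀ x → ∃[ i ] (Near i x × (∀ {j} → Near j x → i ≤ j))
    nearest x = least (λ i → near? i x) (proj₂ (reachable⇒near (connected x root)))

  dist : Fin n → ℕ
  dist x = proj₁ (nearest x)

  dist-near : ∀ x → Near (dist x) x
  dist-near x = proj₁ (proj₂ (nearest x))

  dist-least : ∀ {x i} → Near i x → dist x ≤ i
  dist-least {x} = proj₂ (proj₂ (nearest x))

  dist≡0⇒root : ∀ {x} → dist x ≡ 0 → x ≡ root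
  dist≡0⇒root {x} d≡0 = subst (λ i → Near i x) d≡0 (dist-near x)

  dist-edge : ∀ {x y} → Edge G x y → dist y ≤ suc (dist x)
  dist-edge {x} x—y = dist-least (inj₂ (x , edge-sym G x—y , dist-near x))

  descend : ∀ {x j} → dist x ≡ suc j → ∃[ y ] (Edge G x y × dist y ≡ j)
  descend {x} {j} d≡1+j with subst (λ i → Near i x) d≡1+j (dist-near x)
  ... | inj₁ near = contradiction (subst (_≤ j) d≡1+j (dist-least near)) (n≮n j)
  ... | inj₂ (y , x—y , near) = y , x—y , ≤-antisym (dist-least near) (s≤s⁻¹ 1+j≤1+dy)
    where
    1+j≤1+dy : suc j ≤ suc (dist y)
    1+j≤1+dy = subst (_≤ suc (dist y)) d≡1+j (dist-edge (edge-sym G x—y))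

  toward-root : ∀ x → x ≢ root → ∃[ y ] (Edge G x y × dist y < dist x)
  toward-root x x≢root with dist x in d≡
  ... | zero  = ⊥-elim (x≢root (dist≡0⇒root d≡))
  ... | suc j = let (y , x—y , d≡j) = descend d≡ in y , x—y , s≤s (≤-reflexive d≡j)

  dist-root : dist root ≡ 0
  dist-root = n≤0⇒n≡0 (dist-least refl)

  far-endpoint-edge : ∀ (H : Graph n) {x u} → Edge G x u → dist u < dist x →
                      Edge (union G H) u root → Edge (union G H) x root → Edge H x root
  far-endpoint-edge H {x} {u} x—u u<x u∼root x∼root = union-elimʳ G H x∼root (¬-not x≁root)
    where
    x≁root : ¬ Edge G x root
    x≁root x—root = edge-irrefl (union G H) u∼root (dist≡0⇒root (n≤0⇒n≡0 (s≤s⁻¹ u<1)))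
      where
      u<1 : dist u < 1
      u<1 = ≤-trans u<x (subst (λ d → dist x ≤ suc d) dist-root (dist-edge (edge-sym G x—root)))

  Above : ℕ → Fin n → Set
  Above L x = L ≤ dist x

  below-fresh : ∀ {L x k} {p : Path G k} → dist x ≡ L → All (Above (suc L)) p → All (_≢ x) p
  below-fresh x≡L above = all λ { i refl → <⇒≱ (s≤s (≤-reflexive x≡L)) (holds above i) }

  -- Both ends of the path descend to their parents until these coincide, which closes a
  -- cycle; the parents lie strictly below the path, so each extension is again a path.
  bridge-cycle : ∀ L {k} (p : Path G (suc k)) → dist (first p) ≡ L → dist (last p) ≡ L →
                 All (Above L) p → Cycle G
  bridge-cycle zero p first≡ last≡ _
    with distinct p (trans (dist≡0⇒root first≡) (≡.sym (dist≡0⇒root last≡)))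
  ... | ()
  bridge-cycle (suc L) {k} p first≡ last≡ above with descend first≡ | descend last≡
  ... | s , first—s , s≡L | t , last—t , t≡L with s ≟ᶠ t
  ...   | yes refl = close (prepend s p (edge-sym G first—s) (below-fresh s≡L above)) last—t
  ...   | no s≢t   = bridge-cycle L tsp t≡L (trans (cong dist (last-reverse sp)) s≡L)
                         (All-prepend (≤-reflexive (≡.sym t≡L)) (All-reverse sp-above))
    where
    sp : Path G (suc (suc k))
    sp = prepend s p (edge-sym G first—s) (below-fresh s≡L above)
    sp-above : All (Above L) sp
    sp-above = All-prepend (≤-reflexive (≡.sym s≡L)) (all (≤-trans (n≤1+n L) ∘ holds above))
    tsp : Path G (suc (suc (suc k)))
    tsp = prepend t (reverse sp) (edge-sym G last—t)
            (All-reverse (All-prepend s≢t (below-fresh t≡L above)))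

  module _ (acyclic : Acyclic G) where

    edge⇒dist≢ : ∀ {a b} → Edge G a b → dist a ≢ dist b
    edge⇒dist≢ {a} {b} a—b da≡db = acyclic (bridge-cycle (dist a) ab refl (≡.sym da≡db) above)
      where
      ab = prepend a (singleton b) a—b (all λ _ → edge-irrefl G a—b ∘ ≡.sym)
      above : All (Above (dist a)) ab
      above = All-prepend ≤-refl (all λ _ → ≤-reflexive da≡db)

    lower-neighbour-unique : ∀ {x u u'} → Edge G x u → Edge G x u' →
                             dist u < dist x → dist u' < dist x → u ≡ u'
    lower-neighbour-unique {x} {u} {u'} x—u x—u' u<x u'<x with u ≟ᶠ u'
    ... | yes u≡u' = u≡u'
    ... | no u≢u'  = ⊥-elim (acyclic (bridge-cycle (dist u) uxu' refl du'≡du above))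
      where
      uxu' = prepend u (prepend x (singleton u') x—u' (all λ _ → edge-irrefl G x—u' ∘ ≡.sym))
                    (edge-sym G x—u) (all λ { zero → edge-irrefl G x—u ; (suc zero) → u≢u' ∘ ≡.sym })
      one-below : ∀ {v} → Edge G x v → dist v < dist x → suc (dist v) ≡ dist x
      one-below x—v v<x = ≤-antisym v<x (dist-edge (edge-sym G x—v))
      du'≡du : dist u' ≡ dist u
      du'≡du = suc-injective (trans (one-below x—u' u'<x) (≡.sym (one-below x—u u<x)))
      above : All (Above (dist u)) uxu'
      above = All-prepend ≤-refl (All-prepend (<⇒≤ u<x) (all λ _ → ≤-reflexive (≡.sym du'≡du)))

    record Oriented (a b : Fin n) : Set where
      field
        far near : Fin n
        far—near : Edge G far near
        near<far : dist near < dist far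
        ends     : (far ≡ a × near ≡ b) ⊎ (far ≡ b × near ≡ a)

    open Oriented public

    orient : ∀ {a b} → Edge G a b → Oriented a b
    orient {a} {b} a—b with <-cmp (dist a) (dist b)
    ... | tri< a<b _ _ = record
      { far = b ; near = a ; far—near = edge-sym G a—b ; near<far = a<b ; ends = inj₂ (refl , refl) }
    ... | tri≈ _ a≡b _ = ⊥-elim (edge⇒dist≢ a—b a≡b)
    ... | tri> _ _ b<a = record
      { far = a ; near = b ; far—near = a—b ; near<far = b<a ; ends = inj₁ (refl , refl) }

    oriented-ends : ∀ {P : Fin n → Set} {a b} (o : Oriented a b) → P a → P b → P (far o) × P (near o)
    oriented-ends record { ends = inj₁ (refl , refl) } Pa Pb = Pa , Pb
    oriented-ends record { ends = inj₂ (refl , refl) } Pa Pb = Pb , Pa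

    near-determined : ∀ {a b a' b'} (o : Oriented a b) (o' : Oriented a' b') →
                      far o ≡ far o' → near o ≡ near o'
    near-determined o o' far≡ =
      lower-neighbour-unique (far—near o) (subst (λ x → Edge G x (near o')) (≡.sym far≡) (far—near o'))
        (near<far o) (subst (λ x → dist (near o') < dist x) (≡.sym far≡) (near<far o'))

module TreeEdges {m} (T : Graph (suc m)) (connected : Connected T) (acyclic : Acyclic T)
                 (E' : Graph (suc m)) where

  open Distance T connected zero using (toward-root) renaming (dist to depth)

  private
    up : ∀ i → ∃[ p ] (Edge T (suc i) p × depth p < depth (suc i))
    up i = toward-root (suc i) λ ()

  parent : Fin m → Fin (suc m)
  parent i = proj₁ (up i)

  parent-edge : ∀ i → Edge T (suc i) (parent i)
  parent-edge i = proj₁ (proj₂ (up i))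

  parent-depth : ∀ i → depth (parent i) < depth (suc i)
  parent-depth i = proj₂ (proj₂ (up i))

  Ends : Fin m → Fin (suc m) → Fin (suc m) → Set
  Ends i x u = (x ≡ suc i × u ≡ parent i) ⊎ (x ≡ parent i × u ≡ suc i)

  no-mutual-parents : ∀ {i j} → suc i ≡ parent j → parent i ≡ suc j → ⊥
  no-mutual-parents {i} {j} e₁ e₂ =
    <-asym (subst (_< depth (suc j)) (cong depth (≡.sym e₁)) (parent-depth j))
           (subst (_< depth (suc i)) (cong depth e₂) (parent-depth i))

  ends-determine-edge : ∀ {i j x u} → Ends i x u → Ends j x u → i ≡ j
  ends-determine-edge (inj₁ (refl , _))    (inj₁ (e , _))    = Fin-suc-injective e
  ends-determine-edge (inj₂ (_ , refl))    (inj₂ (_ , e))    = Fin-suc-injective e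
  ends-determine-edge (inj₁ (refl , refl)) (inj₂ (e₁ , e₂)) = ⊥-elim (no-mutual-parents e₁ e₂)
  ends-determine-edge (inj₂ (refl , refl)) (inj₁ (e₁ , e₂)) = ⊥-elim (no-mutual-parents e₂ e₁)

  U : Graph (suc m)
  U = union T E'

  apex : Fin m → Fin (suc m) → Bool
  apex i y = if adj U (suc i) y then adj U (parent i) y else false

  apexes≤degree : ∀ y → ∑[ i < m ] [ apex i y ] ≤ degree E' y
  apexes≤degree y =
    ∑-≤-injection {p = λ i → apex i y} {adj E' y} (far ∘ oriented) far-injective apex⇒edge
    where
    open Distance T connected y
    oriented : ∀ i → Oriented acyclic (suc i) (parent i)
    oriented i = orient acyclic (parent-edge i)
    far-injective : Injective _≡_ _≡_ (far ∘ oriented)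
    far-injective {i} {j} far≡ = ends-determine-edge (ends (oriented i))
      (subst₂ (Ends j) (≡.sym far≡) (≡.sym near≡) (ends (oriented j)))
      where near≡ = near-determined acyclic (oriented i) (oriented j) far≡
    apex⇒edge : ∀ i → apex i y ≡ true → Edge E' y (far (oriented i))
    apex⇒edge i apex≡true =
      let (i∼y , p∼y) = if-true⁻ {adj U (suc i) y} apex≡true
          (far∼y , near∼y) = oriented-ends acyclic {λ v → Edge U v y} (oriented i) i∼y p∼y
      in edge-sym E' (far-endpoint-edge E' (far—near (oriented i)) (near<far (oriented i))
                                         near∼y far∼y)

corollary1 : (n : ℕ) (T : Graph n) → IsTree T → (k : ℕ) → 3 ≤ k →
    (E' : Graph n) → IsCompletionSet (k ∸ 2) T E' →
    (n ∸ 1) * (k ∸ 2) ≤ 2 * numEdges E'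
corollary1 zero    T _                      k _ E' _                = z≤n
corollary1 (suc m) T (connected , acyclic) k _ E' (_ , _ , covered) = begin
  m * (k ∸ 2)                                ≤⟨ n*c≤∑ (k ∸ 2) tree-edge-triangles ⟩
  ∑[ i < m ] triangles U (suc i) (parent i)   ≡⟨ sum-cong-≗ {m} (λ i → count≡∑ (suc m) (apex i)) ⟩
  ∑[ i < m ] ∑[ y < suc m ] [ apex i y ]      ≡⟨ ∑-comm (λ i y → [ apex i y ]) ⟩
  ∑[ y < suc m ] ∑[ i < m ] [ apex i y ]      ≤⟨ ∑-mono-≤ {suc m} apexes≤degree ⟩
  ∑[ y < suc m ] degree E' y                  ≤⟨ handshake E' ⟩
  2 * numEdges E'                             ∎
  where
  open TreeEdges T connected acyclic E'
  open Data.Nat.Properties.≤-Reasoning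
  tree-edge-triangles : ∀ i → k ∸ 2 ≤ triangles U (suc i) (parent i)
  tree-edge-triangles i = covered (suc i) (parent i) (union-introˡ T E' (parent-edge i))
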